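{- In the source detection game with consistent source behavior and unknown static graph, in which the Discoverer watches one node per round, there is a randomized Discoverer algorithm with the following guarantee. For every $n$-node instance, with probability at least a constant $c>0$ independent of $n$ and of the instance, the algorithm finds the source while the price of detection is $O(n\sqrt{n})$.
   Context: A temporal graph $\mathcal{G}=(V,E,\lambda)$ with lifetime $T_{\max}$ consists of a finite simple undirected graph $(V,E)$, called the underlying static graph, together with a labeling $\lambda\colon E\to\{1,\dots,T_{\max}\}$. The edge $e$ is present only at time step $\lambda(e)$. Write $n=|V|$. Infections follow the SIR model with infection duration $\delta\ge1$. A node may be seed-infected at some time. A susceptible node $u$ becomes infected at time $t$ iff some neighbor $v$ is infectious at time $t$ and $\lambda(uv)=t$; exactly one such neighbor counts as its infector. The node $u$ is then infectious at times $t+1,\dots,t+\delta$ and resistant afterwards. SD game: an Adversary fixes a temporal graph, $T_{\max}$, $\delta$, and a source node $s$. The Discoverer is told only $V$, $T_{\max}$ and $\delta$ (unknown static graph: neither $E$ nor $\lambda$ is revealed). In each round the Discoverer watches one node. All nodes start susceptible, the source is seed-infected, and an infection chain unfolds. The Discoverer learns whether the watched node became infected, at what time, and by which neighbor (or that it was the seed). Consistent source behavior means the Adversary produces the same seed time and the same infection chain in every round. The Discoverer eventually names a node and wins iff it is $s$. The price of detection is the total number of nodes infected, summed over all rounds, until the Discoverer stops. -}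

module Defs where

open import Data.Nat using (ℕ; zero; suc; _+_; _*_; _^_; _≤_; _<_)
open import Data.Fin using (Fin)
open import Data.Fin.Subset using (Subset; _∈_; ∣_∣)
open import Data.Bool using (Bool; true; false; if_then_else_)
open import Data.Maybe using (Maybe; just; nothing; is-just)
open import Data.List using (List; []; _∷_; length; map; allFin)
open import Data.Nat.ListAction using (sum)
open import Data.Product using (Σ; _×_; _,_; ∃)
open import Relation.Binary.PropositionalEquality using (_≡_)

record TemporalGraph (n Tmax : ℕ) : Set where
  field
    adj        : Fin n → Fin n → Bool
    adj-sym    : ∀ u v → adj u v ≡ adj v u
    adj-irrefl : ∀ u → adj u u ≡ false
    lab        : Fin n → Fin n → ℕ
    lab-sym    : ∀ u v → lab u v ≡ lab v u
    lab-range  : ∀ u v → adj u v ≡ true → (1 ≤ lab u v) × (lab u v ≤ Tmax)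

open TemporalGraph public

Edge : ∀ {n Tmax} → TemporalGraph n Tmax → Fin n → Fin n → Set
Edge G u v = adj G u v ≡ true

-- Infection chains.  For each node: either never infected (nothing), or
-- infected at time t, either as the seed or by a given neighbour.

data Cause (n : ℕ) : Set where
  seed : Cause n
  by   : Fin n → Cause n

Chain : ℕ → Set
Chain n = Fin n → Maybe (ℕ × Cause n)

InfectiousAt : ∀ {n} → ℕ → Chain n → Fin n → ℕ → Set
InfectiousAt δ ch v t = Σ ℕ λ t' → Σ (Cause _) λ c →
  (ch v ≡ just (t' , c)) × (t' < t) × (t ≤ t' + δ)

-- u is no longer susceptible at time t (infected at some time ≤ t).
InfectedBy : ∀ {n} → Chain n → Fin n → ℕ → Set
InfectedBy ch u t = Σ ℕ λ t' → Σ (Cause _) λ c → (ch u ≡ just (t' , c)) × (t' ≤ t)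

-- ch is an infection chain of the SIR process on G with duration δ,
-- seed s seed-infected at time t0: exactly the SIR rule, with the
-- infector chosen (by the Adversary) among the infectious neighbours.
record ValidChain {n Tmax : ℕ} (G : TemporalGraph n Tmax) (δ : ℕ)
                  (s : Fin n) (t0 : ℕ) (ch : Chain n) : Set where
  field
    seed-ok   : ch s ≡ just (t0 , seed)
    seed-only : ∀ u t → ch u ≡ just (t , seed) → u ≡ s
    by-ok     : ∀ u t v → ch u ≡ just (t , by v) →
                Edge G u v × (lab G u v ≡ t) × InfectiousAt δ ch v t
    closed    : ∀ u v → Edge G u v → InfectiousAt δ ch v (lab G u v) →
                InfectedBy ch u (lab G u v)

-- What the Discoverer learns about the watched node: not infected,
-- or infection time together with the infector (or that it was the seed).
Obs : ℕ → Set
Obs n = Maybe (ℕ × Cause n)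

History : ℕ → Set
History n = List (Fin n × Obs n)

data Move (n : ℕ) : Set where
  watch : Fin n → Move n
  guess : Fin n → Move n

-- Vertex set Fin (suc m) (n = suc m ≥ 1,
-- since a source exists).  Knowing only n, Tmax, δ it draws a uniform
-- random sample r from a finite nonempty space Fin (suc (sampleSize …))
-- and then chooses its moves adaptively from r and the history.
record Discoverer : Set where
  field
    sampleSize : (m Tmax δ : ℕ) → ℕ
    move       : (m Tmax δ : ℕ) → Fin (suc (sampleSize m Tmax δ)) →
                 History (suc m) → Move (suc m)

open Discoverer public

-- Play the game with consistent source behaviour (the same chain ch in
-- every round) for at most `fuel` rounds.  History: newest first.
run : ∀ {n} → (History n → Move n) → Chain n → ℕ → History n →
      Maybe (ℕ × Fin n)
run f ch zero    h = nothing
run f ch (suc k) h with f h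
... | guess g = just (length h , g)
... | watch w = run f ch k ((w , ch w) ∷ h)

numInfected : ∀ {n} → Chain n → ℕ
numInfected {n} ch = sum (map (λ u → if is-just (ch u) then 1 else 0) (allFin n))

-- Price of detection after k rounds: total infected over all rounds.
price : ∀ {n} → Chain n → ℕ → ℕ
price ch k = k * numInfected ch

-- Success of the randomized Discoverer with sample r: it stops, names
-- the source s, and the price P satisfies P ≤ √C · n√n, i.e. P² ≤ C·n³.
Success : (D : Discoverer) (C m Tmax δ : ℕ) →
          Fin (suc (sampleSize D m Tmax δ)) →
          Chain (suc m) → Fin (suc m) → Set
Success D C m Tmax δ r ch s = Σ ℕ λ fuel → Σ ℕ λ k →
  (run (move D m Tmax δ r) ch fuel [] ≡ just (k , s)) ×
  (price ch k * price ch k ≤ C * suc m ^ 3)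

{-# OPTIONS --safe #-}
module Submission where

-- The Discoverer watches x = ⌈√n⌉ uniformly random vertices and then walks the infection chain
-- backwards: it keeps watching the infector of the earliest infection seen so far and names that
-- vertex once it turns out to be the seed; if no sampled vertex was infected, it first scans the
-- vertices in order until it meets an infected one.  Each backward step strictly lowers the rank of
-- the current infection time (the number of vertices infected strictly earlier), so from rank ρ the
-- walk ends within ρ rounds.
-- If at most x vertices are ever infected, every sample leads to O(n) rounds that each infect at
-- most x vertices.  Otherwise at least x vertices have rank < x; a uniform x-sample misses all of
-- them with probability at most (1 - x/n)^x ≤ n/(n + x²) ≤ 1/2 by Bernoulli's inequality, and a
-- sample that hits one finishes within 2x rounds that each infect at most n vertices.  In both
-- cases the price P is at most 3nx, hence P² ≤ 18n³.

open import Defs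
open import Data.Bool using (Bool; true; false; T; not; _∨_; if_then_else_)
open import Data.Bool.ListAction using (any)
open import Data.Empty using (⊥-elim)
open import Data.Fin using (Fin; zero; suc; toℕ; combine; remQuot; _↑ˡ_; _↑ʳ_)
open import Data.Fin.Properties using (remQuot-combine; toℕ-fromℕ<; toℕ-injective; toℕ<n)
open import Data.Fin.Subset using (Subset; _∈_; ∣_∣; ⊤)
open import Data.Fin.Subset.Properties using (∣⊤∣≡n)
open import Data.List using (List; []; _∷_; length; drop)
import Data.List as List
open import Data.List.Properties using (drop-all; drop-drop; map-tabulate)
open import Data.List.Membership.Propositional using (find) renaming (_∈_ to _∈ᴸ_)
open import Data.List.Relation.Unary.All as All using (All; []; _∷_)
open import Data.List.Relation.Unary.Any using (here; there)
open import Data.List.Relation.Unary.Any.Properties using (any⁻)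
open import Data.Maybe using (Maybe; just; nothing; is-just; maybe′)
import Data.Maybe as Maybe
open import Data.Nat using (ℕ; zero; suc; _+_; _*_; _∸_; _^_; _⊓_; _≤_; _<_; _<ᵇ_; z≤n; s≤s; _≤?_; NonZero)
open import Data.Nat.DivMod using (_mod_; m<n⇒m%n≡m)
import Data.Nat.ListAction as ListAction
open import Data.Nat.Properties
open import Algebra.Properties.CommutativeMonoid.Sum +-0-commutativeMonoid using (sum; sum-cong-≗)
open import Algebra.Properties.CommutativeSemigroup +-commutativeSemigroup using (x∙yz≈y∙xz)
open import Data.Nat.Tactic.RingSolver using (solve-∀)
open import Data.Product using (Σ; _×_; _,_; proj₁; proj₂)
open import Data.Vec using (tabulate)
open import Data.Vec.Properties using ([]=⇒lookup; lookup∘tabulate)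
open import Function using (id; _∘_)
open import Relation.Nullary using (yes; no; ¬_)
open import Relation.Binary.PropositionalEquality

sum-mono-≤ : ∀ {k} {f g : Fin k → ℕ} → (∀ i → f i ≤ g i) → sum f ≤ sum g
sum-mono-≤ {zero}  f≤g = z≤n
sum-mono-≤ {suc k} f≤g = +-mono-≤ (f≤g zero) (sum-mono-≤ (f≤g ∘ suc))

sum-mono-< : ∀ {k} {f g : Fin k → ℕ} → (∀ i → f i ≤ g i) → ∀ j → f j < g j → sum f < sum g
sum-mono-< f≤g zero    fj<gj = +-mono-<-≤ fj<gj (sum-mono-≤ (f≤g ∘ suc))
sum-mono-< f≤g (suc j) fj<gj = +-mono-≤-< (f≤g zero) (sum-mono-< (f≤g ∘ suc) j fj<gj)

sum-↑ : ∀ K L (h : Fin (K + L) → ℕ) → sum h ≡ sum (h ∘ (_↑ˡ L)) + sum (h ∘ (K ↑ʳ_))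
sum-↑ zero    L h = refl
sum-↑ (suc K) L h = trans (cong (h zero +_) (sum-↑ K L (h ∘ suc))) (sym (+-assoc (h zero) _ _))

sum-combine : ∀ k K (h : Fin (k * K) → ℕ) → sum h ≡ sum {k} (λ i → sum {K} (λ j → h (combine i j)))
sum-combine zero    K h = refl
sum-combine (suc k) K h =
  trans (sum-↑ K (k * K) h) (cong (sum (λ j → h (j ↑ˡ (k * K))) +_) (sum-combine k K (h ∘ (K ↑ʳ_))))

count : ∀ {k} → (Fin k → Bool) → ℕ
count p = sum (λ i → if p i then 1 else 0)

indicator-mono : ∀ b c → (T b → T c) → (if b then 1 else 0) ≤ (if c then 1 else 0)
indicator-mono true  true  _   = ≤-refl
indicator-mono true  false b⇒c = ⊥-elim (b⇒c _)
indicator-mono false _     _   = z≤n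

count-mono : ∀ {k} {p q : Fin k → Bool} → (∀ i → T (p i) → T (q i)) → count p ≤ count q
count-mono {p = p} {q} p⇒q = sum-mono-≤ (λ i → indicator-mono (p i) (q i) (p⇒q i))

count-mono-< : ∀ {k} {p q : Fin k → Bool} → (∀ i → T (p i) → T (q i)) →
               ∀ j → ¬ T (p j) → T (q j) → count p < count q
count-mono-< {p = p} {q} p⇒q j ¬pj qj =
  sum-mono-< (λ i → indicator-mono (p i) (q i) (p⇒q i)) j (strict (p j) (q j) ¬pj qj)
  where
  strict : ∀ b c → ¬ T b → T c → (if b then 1 else 0) < (if c then 1 else 0)
  strict true  _     ¬b _ = ⊥-elim (¬b _)
  strict false true  _  _ = s≤s z≤n

count-true : ∀ k → count {k} (λ _ → true) ≡ k
count-true zero    = refl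
count-true (suc k) = cong suc (count-true k)

count+count-not : ∀ {k} (p : Fin k → Bool) → count p + count (not ∘ p) ≡ k
count+count-not {zero}  p = refl
count+count-not {suc k} p with p zero
... | true  = cong suc (count+count-not (p ∘ suc))
... | false = trans (+-suc _ _) (cong suc (count+count-not (p ∘ suc)))

count≤ : ∀ {k} (p : Fin k → Bool) → count p ≤ k
count≤ p = subst (count p ≤_) (count+count-not p) (m≤m+n (count p) (count (not ∘ p)))

sum-if : ∀ {k} (p : Fin k → Bool) a b →
         sum (λ i → if p i then a else b) ≡ count p * a + count (not ∘ p) * b
sum-if {zero}  p a b = refl
sum-if {suc k} p a b with p zero
... | true  = trans (cong (a +_) (sum-if (p ∘ suc) a b)) (sym (+-assoc a _ _))
... | false = trans (cong (b +_) (sum-if (p ∘ suc) a b))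
                    (x∙yz≈y∙xz b (count (p ∘ suc) * a) (count (not ∘ p ∘ suc) * b))

⌈√_⌉ : ℕ → ℕ
⌈√ zero  ⌉ = zero
⌈√ suc n ⌉ with suc n ≤? ⌈√ n ⌉ * ⌈√ n ⌉
... | yes _ = ⌈√ n ⌉
... | no  _ = suc ⌈√ n ⌉

record SqrtBounds (n x : ℕ) : Set where
  field
    x≤n    : x ≤ n
    n≤x*x  : n ≤ x * x
    x*x≤2n : x * x ≤ 2 * n

n≤n*n : ∀ n → n ≤ n * n
n≤n*n zero    = z≤n
n≤n*n (suc n) = m≤m*n (suc n) (suc n)

[1+x]²≤2[1+x²] : ∀ x → suc x * suc x ≤ 2 * suc (x * x)
[1+x]²≤2[1+x²] zero    = s≤s z≤n
[1+x]²≤2[1+x²] (suc i) = subst (suc (suc i) * suc (suc i) ≤_) (square-identity i) (m≤m+n _ (i * i))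
  where
  square-identity : ∀ i → suc (suc i) * suc (suc i) + i * i ≡ 2 * suc (suc i * suc i)
  square-identity = solve-∀

⌈√⌉-bounds : ∀ n → SqrtBounds n ⌈√ n ⌉
⌈√⌉-bounds zero = record { x≤n = z≤n ; n≤x*x = z≤n ; x*x≤2n = z≤n }
⌈√⌉-bounds (suc n) with suc n ≤? ⌈√ n ⌉ * ⌈√ n ⌉ | ⌈√⌉-bounds n
... | yes n<x*x | record { x≤n = x≤n ; x*x≤2n = x*x≤2n } = record
  { x≤n    = m≤n⇒m≤1+n x≤n
  ; n≤x*x  = n<x*x
  ; x*x≤2n = ≤-trans x*x≤2n (*-monoʳ-≤ 2 (n≤1+n n))
  }
... | no n≮x*x | record { n≤x*x = n≤x*x } = record
  { x≤n    = s≤s (≤-trans (n≤n*n x) x*x≤n)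
  ; n≤x*x  = s≤s (≤-trans n≤x*x (≤-trans (*-monoʳ-≤ x (n≤1+n x)) (m≤n+m _ x)))
  ; x*x≤2n = ≤-trans ([1+x]²≤2[1+x²] x) (*-monoʳ-≤ 2 (s≤s x*x≤n))
  }
  where
  x = ⌈√ n ⌉
  x*x≤n : x * x ≤ n
  x*x≤n = ≮⇒≥ n≮x*x

bernoulli : ∀ a e y → e ^ y * (e + suc y * a) ≤ (e + a) ^ suc y
bernoulli a e zero = ≤-reflexive (base a e)
  where
  base : ∀ a e → 1 * (e + (a + 0)) ≡ (e + a) * 1
  base = solve-∀
bernoulli a e (suc y) = begin
  e ^ suc y * (e + suc (suc y) * a)     ≡⟨ reassociate (e ^ y) e _ ⟩
  e ^ y * (e * (e + suc (suc y) * a))   ≤⟨ *-monoʳ-≤ (e ^ y) (m≤m+n _ _) ⟩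
  e ^ y * (e * (e + suc (suc y) * a) + suc y * a * a) ≡⟨ cong (e ^ y *_) (expand a e y) ⟩
  e ^ y * ((e + a) * (e + suc y * a))   ≡⟨ left-comm (e ^ y) (e + a) _ ⟩
  (e + a) * (e ^ y * (e + suc y * a))   ≤⟨ *-monoʳ-≤ (e + a) (bernoulli a e y) ⟩
  (e + a) * (e + a) ^ suc y             ∎
  where
  open ≤-Reasoning
  reassociate : ∀ p e q → e * p * q ≡ p * (e * q)
  reassociate = solve-∀
  expand : ∀ a e y → e * (e + suc (suc y) * a) + suc y * a * a ≡ (e + a) * (e + suc y * a)
  expand = solve-∀
  left-comm : ∀ p q r → p * (q * r) ≡ q * (p * r)
  left-comm = solve-∀

2*[n∸x]^x≤n^x : ∀ n x .{{_ : NonZero n}} → x ≤ n → n ≤ x * x → 2 * (n ∸ x) ^ x ≤ n ^ x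
2*[n∸x]^x≤n^x n x x≤n n≤x*x = *-cancelʳ-≤ (2 * (n ∸ x) ^ x) (n ^ x) n (begin
  2 * (n ∸ x) ^ x * n               ≡⟨ double ((n ∸ x) ^ x) n ⟩
  (n ∸ x) ^ x * (n + n)             ≤⟨ *-monoʳ-≤ ((n ∸ x) ^ x) n+n≤ ⟩
  (n ∸ x) ^ x * (n ∸ x + suc x * x) ≤⟨ bernoulli x (n ∸ x) x ⟩
  (n ∸ x + x) ^ suc x               ≡⟨ cong (_^ suc x) n∸x+x≡n ⟩
  n ^ suc x                         ≡⟨ *-comm n (n ^ x) ⟩
  n ^ x * n                         ∎)
  where
  open ≤-Reasoning
  n∸x+x≡n : n ∸ x + x ≡ n
  n∸x+x≡n = m∸n+n≡m x≤n
  n+n≤ : n + n ≤ n ∸ x + suc x * x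
  n+n≤ = begin
    n + n               ≡⟨ cong (_+ n) (sym n∸x+x≡n) ⟩
    n ∸ x + x + n       ≤⟨ +-monoʳ-≤ (n ∸ x + x) n≤x*x ⟩
    n ∸ x + x + x * x   ≡⟨ +-assoc (n ∸ x) x (x * x) ⟩
    n ∸ x + suc x * x   ∎
  double : ∀ E n → 2 * E * n ≡ E * (n + n)
  double = solve-∀

-- Fin (suc (pred^ m y)) indexes the sequences of y vertices of Fin (suc m); pred^ is arranged so
-- that suc (pred^ m (suc y)) reduces to suc m * suc (pred^ m y), the index type of remQuot.
pred^ : ℕ → ℕ → ℕ
pred^ m zero    = zero
pred^ m (suc y) = pred^ m y + m * suc (pred^ m y)

suc-pred^ : ∀ m y → suc (pred^ m y) ≡ suc m ^ y
suc-pred^ m zero    = refl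
suc-pred^ m (suc y) = cong (suc m *_) (suc-pred^ m y)

decode : ∀ {m} y → Fin (suc (pred^ m y)) → List (Fin (suc m))
decode         zero    r = []
decode {m} (suc y) r = let (i , j) = remQuot {suc m} (suc (pred^ m y)) r in i ∷ decode y j

length-decode : ∀ {m} y (r : Fin (suc (pred^ m y))) → length (decode y r) ≡ y
length-decode zero    r = refl
length-decode (suc y) r = cong suc (length-decode y _)

hits : ∀ {m} → (Fin (suc m) → Bool) → ∀ y → Fin (suc (pred^ m y)) → Bool
hits B y r = any B (decode y r)

count-hits-suc : ∀ {m} (B : Fin (suc m) → Bool) y →
                 count (hits B (suc y)) ≡ count B * suc (pred^ m y) + count (not ∘ B) * count (hits B y)
count-hits-suc {m} B y = begin
  count (hits B (suc y))
    ≡⟨ sum-combine (suc m) K (λ r → if hits B (suc y) r then 1 else 0) ⟩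
  sum {suc m} (λ i → count (hits B (suc y) ∘ combine i))
    ≡⟨ sum-cong-≗ (λ i → sum-cong-≗ (decode-combine i)) ⟩
  sum (λ i → count (λ j → B i ∨ hits B y j))        ≡⟨ sum-cong-≗ (λ i → row (B i)) ⟩
  sum (λ i → if B i then K else count (hits B y))   ≡⟨ sum-if B K (count (hits B y)) ⟩
  count B * K + count (not ∘ B) * count (hits B y)  ∎
  where
  open ≡-Reasoning
  K = suc (pred^ m y)
  decode-combine : ∀ i j → (if hits B (suc y) (combine i j) then 1 else 0) ≡
                           (if B i ∨ hits B y j then 1 else 0)
  decode-combine i j =
    cong (λ (i′ , j′) → if B i′ ∨ hits B y j′ then 1 else 0) (remQuot-combine {suc m} {K} i j)
  row : ∀ b → count (λ j → b ∨ hits B y j) ≡ (if b then K else count (hits B y))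
  row true  = count-true K
  row false = refl

count-hits-bound : ∀ {m} (B : Fin (suc m) → Bool) y → suc m ^ y ≤ count (hits B y) + count (not ∘ B) ^ y
count-hits-bound B zero = ≤-refl
count-hits-bound {m} B (suc y) = begin
  suc m ^ suc y                     ≡⟨ cong (suc m *_) (sym (suc-pred^ m y)) ⟩
  suc m * K                         ≡⟨ cong (_* K) (sym (count+count-not B)) ⟩
  (b + c) * K                       ≡⟨ *-distribʳ-+ K b c ⟩
  b * K + c * K                     ≤⟨ +-monoʳ-≤ (b * K) (*-monoʳ-≤ c K≤) ⟩
  b * K + c * (G + c ^ y)           ≡⟨ regroup (b * K) c G (c ^ y) ⟩
  (b * K + c * G) + c ^ suc y       ≡⟨ cong (_+ c ^ suc y) (sym (count-hits-suc B y)) ⟩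
  count (hits B (suc y)) + c ^ suc y ∎
  where
  open ≤-Reasoning
  K = suc (pred^ m y)
  G = count (hits B y)
  b = count B
  c = count (not ∘ B)
  K≤ : K ≤ G + c ^ y
  K≤ = subst (_≤ G + c ^ y) (sym (suc-pred^ m y)) (count-hits-bound B y)
  regroup : ∀ p c G z → p + c * (G + z) ≡ (p + c * G) + c * z
  regroup = solve-∀

hits-at-least-half : ∀ {m} (B : Fin (suc m) → Bool) x → x ≤ count B → suc m ≤ x * x →
                     suc m ^ x ≤ 2 * count (hits B x)
hits-at-least-half {m} B x x≤b n≤x*x = +-cancelʳ-≤ (n ^ x) (n ^ x) (2 * G) (begin
  n ^ x + n ^ x                      ≡⟨ cong (n ^ x +_) (sym (+-identityʳ (n ^ x))) ⟩
  2 * n ^ x                          ≤⟨ *-monoʳ-≤ 2 (count-hits-bound B x) ⟩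
  2 * (G + c ^ x)                    ≡⟨ *-distribˡ-+ 2 G (c ^ x) ⟩
  2 * G + 2 * c ^ x                  ≤⟨ +-monoʳ-≤ (2 * G) (*-monoʳ-≤ 2 (^-monoˡ-≤ x c≤n∸x)) ⟩
  2 * G + 2 * (n ∸ x) ^ x            ≤⟨ +-monoʳ-≤ (2 * G) (2*[n∸x]^x≤n^x n x x≤n n≤x*x) ⟩
  2 * G + n ^ x                      ∎)
  where
  open ≤-Reasoning
  n = suc m
  G = count (hits B x)
  c = count (not ∘ B)
  x≤n : x ≤ n
  x≤n = ≤-trans x≤b (count≤ B)
  c≤n∸x : c ≤ n ∸ x
  c≤n∸x = begin
    c                   ≡⟨ sym (m+n∸m≡n (count B) c) ⟩
    count B + c ∸ count B ≡⟨ cong (_∸ count B) (count+count-not B) ⟩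
    n ∸ count B         ≤⟨ ∸-monoʳ-≤ n x≤b ⟩
    n ∸ x               ∎

module Ranks {k : ℕ} (time : Fin k → Maybe ℕ) where

  infected : ℕ
  infected = count (is-just ∘ time)

  before : ℕ → Fin k → Bool
  before τ w = maybe′ (_<ᵇ τ) false (time w)

  rank : ℕ → ℕ
  rank τ = count (before τ)

  early : ℕ → Fin k → Bool
  early a w = maybe′ (λ t → rank t <ᵇ a) false (time w)

  before-mono : ∀ {τ τ′} → τ ≤ τ′ → ∀ w → T (before τ w) → T (before τ′ w)
  before-mono {τ} τ≤τ′ w with time w
  ... | just t  = λ t<τ → <⇒<ᵇ (<-≤-trans (<ᵇ⇒< t τ t<τ) τ≤τ′)
  ... | nothing = λ ()

  rank-mono : ∀ {τ τ′} → τ ≤ τ′ → rank τ ≤ rank τ′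
  rank-mono τ≤τ′ = count-mono (before-mono τ≤τ′)

  rank-< : ∀ {v t τ} → time v ≡ just t → t < τ → rank t < rank τ
  rank-< {v} {t} {τ} tv≡t t<τ = count-mono-< (before-mono (<⇒≤ t<τ)) v v-not-before-t v-before-τ
    where
    v-not-before-t : ¬ T (before t v)
    v-not-before-t rewrite tv≡t = λ t<t → <-irrefl refl (<ᵇ⇒< t t t<t)
    v-before-τ : T (before τ v)
    v-before-τ rewrite tv≡t = <⇒<ᵇ t<τ

  rank≤infected : ∀ τ → rank τ ≤ infected
  rank≤infected τ = count-mono infected-before
    where
    infected-before : ∀ w → T (before τ w) → T (is-just (time w))
    infected-before w with time w
    ... | just _  = _
    ... | nothing = λ ()

  early-time : ∀ {a w} → T (early a w) → Σ ℕ λ t → (time w ≡ just t) × (rank t < a)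
  early-time {a} {w} with time w
  ... | just t  = λ rank<a → t , refl , <ᵇ⇒< (rank t) a rank<a
  ... | nothing = λ ()

  -- Once a time τ has fewer than a earlier infections, everything infected up to τ is early.
  a⊓rank≤early : ∀ a τ → a ⊓ rank τ ≤ count (early a)
  a⊓rank≤early a zero = ≤-trans (m⊓n≤n a (rank 0)) (count-mono never-before-0)
    where
    never-before-0 : ∀ w → T (before 0 w) → T (early a w)
    never-before-0 w with time w
    ... | just t  = λ t<0 → ⊥-elim (n≮0 (<ᵇ⇒< t 0 t<0))
    ... | nothing = λ ()
  a⊓rank≤early a (suc τ) with rank τ <? a
  ... | yes rankτ<a = ≤-trans (m⊓n≤n a (rank (suc τ))) (count-mono up-to-τ-early)
    where
    up-to-τ-early : ∀ w → T (before (suc τ) w) → T (early a w)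
    up-to-τ-early w with time w
    ... | just t  = λ t<1+τ → <⇒<ᵇ (≤-<-trans (rank-mono (≤-pred (<ᵇ⇒< t (suc τ) t<1+τ))) rankτ<a)
    ... | nothing = λ ()
  ... | no rankτ≮a = ≤-trans (m⊓n≤m a (rank (suc τ)))
                             (subst (_≤ count (early a)) (m≤n⇒m⊓n≡m (≮⇒≥ rankτ≮a)) (a⊓rank≤early a τ))

  a⊓infected≤early : ∀ {H} → (∀ w t → time w ≡ just t → t < H) → ∀ a → a ⊓ infected ≤ count (early a)
  a⊓infected≤early {H} bounded a = ≤-trans (⊓-monoʳ-≤ a (count-mono infected-before-H)) (a⊓rank≤early a H)
    where
    infected-before-H : ∀ w → T (is-just (time w)) → T (before H w)
    infected-before-H w with time w in tw
    ... | just t  = λ _ → <⇒<ᵇ (bounded w t tw)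
    ... | nothing = λ ()

Report : ℕ → Set
Report n = Fin n × ℕ × Cause n

reportTime : ∀ {n} → Report n → ℕ
reportTime (_ , t , _) = t

module Play {n : ℕ} where

  Faithful : Chain n → History n → Set
  Faithful ch = All (λ (w , o) → o ≡ ch w)

  watchAll : Chain n → List (Fin n) → History n → History n
  watchAll ch []       h = h
  watchAll ch (w ∷ ws) h = watchAll ch ws ((w , ch w) ∷ h)

  length-watchAll : ∀ ch ws h → length (watchAll ch ws h) ≡ length ws + length h
  length-watchAll ch []       h = refl
  length-watchAll ch (w ∷ ws) h = trans (length-watchAll ch ws _) (+-suc (length ws) (length h))

  watchAll-faithful : ∀ {ch} ws {h} → Faithful ch h → Faithful ch (watchAll ch ws h)
  watchAll-faithful []       faithful = faithful
  watchAll-faithful (w ∷ ws) faithful = watchAll-faithful ws (refl ∷ faithful)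

  ∈-watchAll⁺ : ∀ ch ws h {e} → e ∈ᴸ h → e ∈ᴸ watchAll ch ws h
  ∈-watchAll⁺ ch []       h e∈h = e∈h
  ∈-watchAll⁺ ch (w ∷ ws) h e∈h = ∈-watchAll⁺ ch ws _ (there e∈h)

  ∈-watchAll : ∀ ch ws h {w} → w ∈ᴸ ws → (w , ch w) ∈ᴸ watchAll ch ws h
  ∈-watchAll ch (w ∷ ws) h (here refl)  = ∈-watchAll⁺ ch ws _ (here refl)
  ∈-watchAll ch (_ ∷ ws) h (there w∈ws) = ∈-watchAll ch ws _ w∈ws

  NamesWithin : (History n → Move n) → Chain n → History n → Fin n → ℕ → Set
  NamesWithin f ch h s k = Σ ℕ λ fuel → Σ ℕ λ d → (d ≤ k) × (run f ch fuel h ≡ just (length h + d , s))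

  module _ {f : History n → Move n} {ch : Chain n} {s : Fin n} where

    names-guess : ∀ {h} → f h ≡ guess s → NamesWithin f ch h s 0
    names-guess {h} fh≡ = 1 , 0 , z≤n , run≡
      where
      run≡ : run f ch 1 h ≡ just (length h + 0 , s)
      run≡ rewrite fh≡ | +-identityʳ (length h) = refl

    names-watch : ∀ {h w k} → f h ≡ watch w → NamesWithin f ch ((w , ch w) ∷ h) s k →
                  NamesWithin f ch h s (suc k)
    names-watch {h} {w} fh≡ (fuel , d , d≤k , run≡) = suc fuel , suc d , s≤s d≤k , run≡′
      where
      run≡′ : run f ch (suc fuel) h ≡ just (length h + suc d , s)
      run≡′ rewrite fh≡ | +-suc (length h) d = run≡

    names-weaken : ∀ {h k k′} → k ≤ k′ → NamesWithin f ch h s k → NamesWithin f ch h s k′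
    names-weaken k≤k′ (fuel , d , d≤k , run≡) = fuel , d , ≤-trans d≤k k≤k′ , run≡

module Strategy {m : ℕ} where

  open Play

  private
    N = suc m

  keepEarlier : Report N → Maybe (Report N) → Report N
  keepEarlier r nothing   = r
  keepEarlier r@(_ , t , _) (just r′@(_ , t′ , _)) = if t′ <ᵇ t then r′ else r

  earliest : History N → Maybe (Report N)
  earliest []                       = nothing
  earliest ((w , nothing) ∷ h)      = earliest h
  earliest ((w , just (t , c)) ∷ h) = just (keepEarlier (w , t , c) (earliest h))

  respond : List (Fin N) → ℕ → Maybe (Report N) → Move N
  respond (w ∷ _) _ _                      = watch w
  respond []      j nothing                = watch (j mod N)
  respond []      _ (just (u , _ , seed))  = guess u
  respond []      _ (just (_ , _ , by v))  = watch v

  -- The j-th round after the sample L scans vertex j mod N, as long as no infection has been seen.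
  strategy : List (Fin N) → History N → Move N
  strategy L h = respond (drop (length h) L) (length h ∸ length L) (earliest h)

  strategy-after-sample : ∀ L h → length L ≤ length h →
                          strategy L h ≡ respond [] (length h ∸ length L) (earliest h)
  strategy-after-sample L h sampled =
    cong (λ rest → respond rest (length h ∸ length L) (earliest h)) (drop-all (length h) L sampled)

  earliest-∈ : ∀ h {u t c} → earliest h ≡ just (u , t , c) → (u , just (t , c)) ∈ᴸ h
  earliest-∈ ((w , nothing) ∷ h) e = there (earliest-∈ h e)
  earliest-∈ ((w , just (t , c)) ∷ h) e with earliest h in eh
  earliest-∈ ((w , just (t , c)) ∷ h) refl | nothing = here refl
  earliest-∈ ((w , just (t , c)) ∷ h) e    | just (u′ , t′ , c′) with t′ <ᵇ t
  ... | true  = there (earliest-∈ h (trans eh e))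
  earliest-∈ ((w , just (t , c)) ∷ h) refl | just (u′ , t′ , c′) | false = here refl

  keepEarlier-≤ˡ : ∀ r mr → reportTime (keepEarlier r mr) ≤ reportTime r
  keepEarlier-≤ˡ r nothing = ≤-refl
  keepEarlier-≤ˡ (_ , t , _) (just (_ , t′ , _)) with t′ <ᵇ t in e
  ... | true  = <⇒≤ (<ᵇ⇒< t′ t (subst T (sym e) _))
  ... | false = ≤-refl

  keepEarlier-≤ʳ : ∀ r r′ → reportTime (keepEarlier r (just r′)) ≤ reportTime r′
  keepEarlier-≤ʳ (_ , t , _) (_ , t′ , _) with t′ <ᵇ t in e
  ... | true  = ≤-refl
  ... | false = ≮⇒≥ (λ t′<t → subst T e (<⇒<ᵇ t′<t))

  earliest-≤ : ∀ h {w t c} → (w , just (t , c)) ∈ᴸ h →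
               Σ (Report N) λ r → (earliest h ≡ just r) × (reportTime r ≤ t)
  earliest-≤ ((_ , nothing) ∷ h) (there p) = earliest-≤ h p
  earliest-≤ ((w , just (t , c)) ∷ h) (here refl) = _ , refl , keepEarlier-≤ˡ (w , t , c) (earliest h)
  earliest-≤ ((w , just (t , c)) ∷ h) (there p) with earliest-≤ h p
  ... | r , eh , r≤ rewrite eh = _ , refl , ≤-trans (keepEarlier-≤ʳ (w , t , c) r) r≤

  earliest-∷ : ∀ h {r v t c} → earliest h ≡ just r → t < reportTime r →
               earliest ((v , just (t , c)) ∷ h) ≡ just (v , t , c)
  earliest-∷ h {r@(_ , t′ , _)} {t = t} eh t<t′ rewrite eh with t′ <ᵇ t in e
  ... | true  = ⊥-elim (<-asym t<t′ (<ᵇ⇒< t′ t (subst T (sym e) _)))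
  ... | false = refl

  names-sample : ∀ {ch s} L ws h → drop (length h) L ≡ ws → ∀ {k} →
                 NamesWithin (strategy L) ch (watchAll ch ws h) s k →
                 NamesWithin (strategy L) ch h s (length ws + k)
  names-sample L []       h _      names = names
  names-sample L (w ∷ ws) h drop≡ names =
    names-watch (cong (λ rest → respond rest (length h ∸ length L) (earliest h)) drop≡)
                (names-sample L ws _ drop-suc names)
    where
    drop-suc : drop (suc (length h)) L ≡ ws
    drop-suc = trans (cong (λ i → drop i L) (+-comm 1 (length h)))
                     (trans (sym (drop-drop (length h) 1 L)) (cong (drop 1) drop≡))

  report-faithful : ∀ {ch h u t c} → Faithful ch h → earliest h ≡ just (u , t , c) → ch u ≡ just (t , c)
  report-faithful {h = h} faithful eh = sym (All.lookup faithful (earliest-∈ h eh))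

infectionTime : ∀ {n} → Chain n → Fin n → Maybe ℕ
infectionTime ch = Maybe.map proj₁ ∘ ch

infectionTime-just : ∀ {n} (ch : Chain n) {w t} → infectionTime ch w ≡ just t → Σ (Cause n) λ c → ch w ≡ just (t , c)
infectionTime-just ch {w} tw≡ with ch w
infectionTime-just ch refl | just (t , c) = c , refl

toℕ-mod : ∀ {n} (i : Fin (suc n)) → toℕ i mod suc n ≡ i
toℕ-mod i = toℕ-injective (trans (toℕ-fromℕ< _) (m<n⇒m%n≡m (toℕ<n i)))

module Detection {m Tmax δ : ℕ} {G : TemporalGraph (suc m) Tmax} {s : Fin (suc m)} {t0 : ℕ} {ch : Chain (suc m)}
                 (valid : ValidChain G δ s t0 ch) where

  open ValidChain valid
  open Play
  open Strategy
  open Ranks (infectionTime ch)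

  private
    N = suc m

  infector-earlier : ∀ {u t v} → ch u ≡ just (t , by v) →
                     Σ ℕ λ tv → Σ (Cause N) λ cv → (ch v ≡ just (tv , cv)) × (tv < t)
  infector-earlier {u} {t} {v} chu with by-ok u t v chu
  ... | _ , _ , tv , cv , chv , tv<t , _ = tv , cv , chv , tv<t

  infection-before-horizon : ∀ w t → infectionTime ch w ≡ just t → t < suc (t0 + Tmax)
  infection-before-horizon w t tw≡ with ch w in chw
  infection-before-horizon w t refl | just (t , seed) with seed-only w t chw
  ... | refl with trans (sym chw) seed-ok
  ... | refl = s≤s (m≤m+n t0 Tmax)
  infection-before-horizon w t refl | just (t , by v) with by-ok w t v chw
  ... | wv , λwv≡t , _ = s≤s (≤-trans (subst (_≤ Tmax) λwv≡t (proj₂ (lab-range G w v wv))) (m≤n+m Tmax t0))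

  module _ (L : List (Fin N)) where

    names-by-backtracking : ∀ R h {u t c} → Faithful ch h → length L ≤ length h →
                            earliest h ≡ just (u , t , c) → rank t ≤ R → NamesWithin (strategy L) ch h s R
    names-by-backtracking R h {u} {t} {seed} faithful sampled eh _ = names-weaken z≤n (names-guess move≡)
      where
      move≡ : strategy L h ≡ guess s
      move≡ = trans (strategy-after-sample L h sampled)
                    (trans (cong (respond [] _) eh) (cong guess (seed-only u t (report-faithful faithful eh))))
    names-by-backtracking R h {c = by v} faithful sampled eh rank≤R
      with infector-earlier (report-faithful faithful eh)
    ... | tv , cv , chv , tv<t with R | <-≤-trans (rank-< (cong (Maybe.map proj₁) chv) tv<t) rank≤R
    ...   | suc R′ | s≤s rank-tv≤R′ =
      names-watch move≡ (names-by-backtracking R′ ((v , ch v) ∷ h) (refl ∷ faithful) (m≤n⇒m≤1+n sampled)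
                                               earliest≡ rank-tv≤R′)
      where
      move≡ : strategy L h ≡ watch v
      move≡ = trans (strategy-after-sample L h sampled) (cong (respond [] _) eh)
      earliest≡ : earliest ((v , ch v) ∷ h) ≡ just (v , tv , cv)
      earliest≡ = subst (λ o → earliest ((v , o) ∷ h) ≡ just (v , tv , cv)) (sym chv) (earliest-∷ h eh tv<t)

    scanning-move : ∀ j h → length h ≡ length L + j → earliest h ≡ nothing → strategy L h ≡ watch (j mod N)
    scanning-move j h lh≡ eh =
      trans (strategy-after-sample L h (≤-trans (m≤m+n (length L) j) (≤-reflexive (sym lh≡))))
            (cong₂ (respond []) (trans (cong (_∸ length L) lh≡) (m+n∸m≡n (length L) j)) eh)

    names-by-scanning : ∀ D j h → D + j ≡ toℕ s → length h ≡ length L + j → earliest h ≡ nothing →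
                        Faithful ch h → NamesWithin (strategy L) ch h s (suc D + infected)
    names-by-scanning D j h D+j≡s lh≡ eh faithful with ch (j mod N) in chw
    ... | just (tw , cw) =
      names-watch (scanning-move j h lh≡ eh)
        (names-weaken (≤-trans (rank≤infected tw) (m≤n+m infected D))
          (names-by-backtracking (rank tw) ((j mod N , ch (j mod N)) ∷ h) (refl ∷ faithful) sampled
                                 earliest≡ ≤-refl))
      where
      sampled : length L ≤ suc (length h)
      sampled = ≤-trans (m≤m+n (length L) (suc j))
                        (≤-reflexive (trans (+-suc (length L) j) (sym (cong suc lh≡))))
      earliest≡ : earliest ((j mod N , ch (j mod N)) ∷ h) ≡ just (j mod N , tw , cw)
      earliest≡ = subst (λ o → earliest ((j mod N , o) ∷ h) ≡ just (j mod N , tw , cw)) (sym chw)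
                        (cong (just ∘ keepEarlier (j mod N , tw , cw)) eh)
    names-by-scanning zero j h j≡s lh≡ eh faithful | nothing
      -- here j mod N is the source, which is infected
      with trans (sym seed-ok) (trans (cong ch (trans (sym (toℕ-mod s)) (cong (_mod N) (sym j≡s)))) chw)
    ... | ()
    names-by-scanning (suc D) j h D+j≡s lh≡ eh faithful | nothing =
      names-watch (scanning-move j h lh≡ eh)
        (names-by-scanning D (suc j) ((j mod N , ch (j mod N)) ∷ h) (trans (+-suc D j) D+j≡s)
              (trans (cong suc lh≡) (sym (+-suc (length L) j))) earliest≡ (refl ∷ faithful))
      where
      earliest≡ : earliest ((j mod N , ch (j mod N)) ∷ h) ≡ nothing
      earliest≡ = subst (λ o → earliest ((j mod N , o) ∷ h) ≡ nothing) (sym chw) eh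

    names-after-sample : ∀ h → Faithful ch h → length h ≡ length L →
                         NamesWithin (strategy L) ch h s (N + infected)
    names-after-sample h faithful lh≡ with earliest h in eh
    ... | just (u , t , c) = names-weaken (≤-trans (rank≤infected t) (m≤n+m infected N))
                                          (names-by-backtracking (rank t) h faithful (≤-reflexive (sym lh≡)) eh ≤-refl)
    ... | nothing = names-weaken (+-monoˡ-≤ infected (toℕ<n s))
                                 (names-by-scanning (toℕ s) 0 h (+-identityʳ (toℕ s)) lh≡′ eh faithful)
      where
      lh≡′ : length h ≡ length L + 0
      lh≡′ = trans lh≡ (sym (+-identityʳ (length L)))

    names-after-hit : ∀ {a v} → v ∈ᴸ L → T (early a v) → NamesWithin (strategy L) ch (watchAll ch L []) s a
    names-after-hit {a} {v} v∈L early-v with early-time early-v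
    ... | tv , tv≡ , rank-tv<a with infectionTime-just ch tv≡
    ...   | cv , chv
      with earliest-≤ (watchAll ch L []) (subst (λ o → (v , o) ∈ᴸ watchAll ch L []) chv (∈-watchAll ch L [] v∈L))
    ...     | (u , t , c) , eh , t≤tv =
      names-by-backtracking a (watchAll ch L []) (watchAll-faithful L []) sampled eh
                            (<⇒≤ (≤-<-trans (rank-mono t≤tv) rank-tv<a))
      where
      sampled : length L ≤ length (watchAll ch L [])
      sampled = ≤-reflexive (sym (trans (length-watchAll ch L []) (+-identityʳ (length L))))

sum-tabulate : ∀ {k} (f : Fin k → ℕ) → ListAction.sum (List.tabulate f) ≡ sum f
sum-tabulate {zero}  f = refl
sum-tabulate {suc k} f = cong (f zero +_) (sum-tabulate (f ∘ suc))

numInfected≡infected : ∀ {n} (ch : Chain n) → numInfected ch ≡ Ranks.infected (infectionTime ch)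
numInfected≡infected {n} ch = begin
  numInfected ch                     ≡⟨ cong ListAction.sum (map-tabulate id f) ⟩
  ListAction.sum (List.tabulate f)   ≡⟨ sum-tabulate f ⟩
  sum f                              ≡⟨ sum-cong-≗ (λ w → cong (λ b → if b then 1 else 0) (is-just-time (ch w))) ⟩
  Ranks.infected (infectionTime ch)  ∎
  where
  open ≡-Reasoning
  f : Fin n → ℕ
  f u = if is-just (ch u) then 1 else 0
  is-just-time : (o : Maybe (ℕ × Cause n)) → is-just o ≡ is-just (Maybe.map proj₁ o)
  is-just-time (just _) = refl
  is-just-time nothing  = refl

∣tabulate∣≡count : ∀ {k} (p : Fin k → Bool) → ∣ tabulate p ∣ ≡ count p
∣tabulate∣≡count {zero}  p = refl
∣tabulate∣≡count {suc k} p with p zero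
... | true  = cong suc (∣tabulate∣≡count (p ∘ suc))
... | false = ∣tabulate∣≡count (p ∘ suc)

∈-tabulate⁻ : ∀ {k} {p : Fin k → Bool} {i} → i ∈ tabulate p → T (p i)
∈-tabulate⁻ {p = p} {i} i∈ = subst T (trans (sym ([]=⇒lookup i∈)) (lookup∘tabulate p i)) _

price-bound : ∀ n x P → x * x ≤ 2 * n → P ≤ 3 * n * x → P * P ≤ 18 * n ^ 3
price-bound n x P x*x≤2n P≤ = begin
  P * P                         ≤⟨ *-mono-≤ P≤ P≤ ⟩
  3 * n * x * (3 * n * x)       ≡⟨ square n x ⟩
  9 * (n * n) * (x * x)         ≤⟨ *-monoʳ-≤ (9 * (n * n)) x*x≤2n ⟩
  9 * (n * n) * (2 * n)         ≡⟨ cube n ⟩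
  18 * n ^ 3                    ∎
  where
  open ≤-Reasoning
  square : ∀ n x → 3 * n * x * (3 * n * x) ≡ 9 * (n * n) * (x * x)
  square = solve-∀
  cube : ∀ n → 9 * (n * n) * (2 * n) ≡ 18 * (n * (n * (n * 1)))
  cube = solve-∀

discoverer : Discoverer
discoverer = record
  { sampleSize = λ m _ _ → pred^ m ⌈√ suc m ⌉
  ; move       = λ m _ _ r → Strategy.strategy (decode ⌈√ suc m ⌉ r)
  }

module Game {m Tmax δ : ℕ} {G : TemporalGraph (suc m) Tmax} {s : Fin (suc m)} {t0 : ℕ} {ch : Chain (suc m)}
            (valid : ValidChain G δ s t0 ch) where

  open Play
  open Strategy
  open Ranks (infectionTime ch)
  open Detection valid
  open SqrtBounds (⌈√⌉-bounds (suc m))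

  private
    N = suc m
    x = ⌈√ N ⌉
    K : ℕ
    K = suc (pred^ m x)

  succeeds : ∀ r {k} → NamesWithin (strategy (decode x r)) ch [] s k → k * infected ≤ 3 * N * x →
             Success discoverer 18 m Tmax δ r ch s
  succeeds r {k} (fuel , d , d≤k , run≡) k*I≤ = fuel , d , run≡ , price-bound N x (price ch d) x*x≤2n price≤
    where
    price≤ : d * numInfected ch ≤ 3 * N * x
    price≤ = ≤-trans (≤-reflexive (cong (d *_) (numInfected≡infected ch)))
                     (≤-trans (*-monoˡ-≤ infected d≤k) k*I≤)

  names-from-start : ∀ r {k} → NamesWithin (strategy (decode x r)) ch (watchAll ch (decode x r) []) s k →
                     NamesWithin (strategy (decode x r)) ch [] s (x + k)
  names-from-start r {k} names =
    subst (λ l → NamesWithin (strategy (decode x r)) ch [] s (l + k)) (length-decode x r)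
          (names-sample (decode x r) (decode x r) [] refl names)

  succeeds-if-few-infected : infected ≤ x → ∀ r → Success discoverer 18 m Tmax δ r ch s
  succeeds-if-few-infected I≤x r =
    succeeds r (names-from-start r (names-after-sample L (watchAll ch L []) (watchAll-faithful L []) lh≡)) bound
    where
    L = decode x r
    lh≡ : length (watchAll ch L []) ≡ length L
    lh≡ = trans (length-watchAll ch L []) (+-identityʳ (length L))
    bound : (x + (N + infected)) * infected ≤ 3 * N * x
    bound = begin
      (x + (N + infected)) * infected ≤⟨ *-mono-≤ (+-mono-≤ x≤n (+-monoʳ-≤ N (≤-trans I≤x x≤n))) I≤x ⟩
      (N + (N + N)) * x               ≡⟨ cong (_* x) (solve-3N N) ⟩
      3 * N * x                       ∎
      where
      open ≤-Reasoning
      solve-3N : ∀ N → N + (N + N) ≡ 3 * N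
      solve-3N = solve-∀

  succeeds-if-sample-hits-early : ∀ r → T (hits (early x) x r) → Success discoverer 18 m Tmax δ r ch s
  succeeds-if-sample-hits-early r hit with find (any⁻ (early x) (decode x r) hit)
  ... | v , v∈L , early-v = succeeds r (names-from-start r (names-after-hit (decode x r) v∈L early-v)) bound
    where
    bound : (x + x) * infected ≤ 3 * N * x
    bound = begin
      (x + x) * infected        ≤⟨ *-monoʳ-≤ (x + x) (count≤ (is-just ∘ infectionTime ch)) ⟩
      (x + x) * N               ≤⟨ m≤m+n ((x + x) * N) (N * x) ⟩
      (x + x) * N + N * x       ≡⟨ solve-3Nx N x ⟩
      3 * N * x                 ∎
      where
      open ≤-Reasoning
      solve-3Nx : ∀ N x → (x + x) * N + N * x ≡ 3 * N * x
      solve-3Nx = solve-∀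

  most-samples-succeed : Σ (Subset K) λ S → ((r : Fin K) → r ∈ S → Success discoverer 18 m Tmax δ r ch s) ×
                                           (1 * K ≤ 2 * ∣ S ∣)
  most-samples-succeed with infected ≤? x
  ... | yes I≤x = ⊤ , (λ r _ → succeeds-if-few-infected I≤x r) ,
                  subst (λ c → 1 * K ≤ 2 * c) (sym (∣⊤∣≡n K)) (*-monoˡ-≤ K {1} {2} (s≤s z≤n))
  ... | no I≰x = tabulate (hits (early x) x) ,
                 (λ r r∈S → succeeds-if-sample-hits-early r (∈-tabulate⁻ {p = hits (early x) x} r∈S)) , half
    where
    x≤early : x ≤ count (early x)
    x≤early = subst (_≤ count (early x)) (m≤n⇒m⊓n≡m (<⇒≤ (≰⇒> I≰x))) (a⊓infected≤early infection-before-horizon x)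
    half : 1 * K ≤ 2 * ∣ tabulate (hits (early x) x) ∣
    half = subst₂ (λ a c → a ≤ 2 * c) (trans (sym (suc-pred^ m x)) (sym (*-identityˡ _)))
                  (sym (∣tabulate∣≡count (hits (early x) x))) (hits-at-least-half (early x) x x≤early n≤x*x)

theorem1 : Σ Discoverer λ D → Σ ℕ λ p → Σ ℕ λ q → (1 ≤ p) × (1 ≤ q) × Σ ℕ λ C →
    (m Tmax δ : ℕ) → 1 ≤ δ →
    (G : TemporalGraph (suc m) Tmax) (s : Fin (suc m)) (t0 : ℕ) (ch : Chain (suc m)) →
    ValidChain G δ s t0 ch →
    Σ (Subset (suc (sampleSize D m Tmax δ))) λ S →
    ((r : Fin (suc (sampleSize D m Tmax δ))) → r ∈ S → Success D C m Tmax δ r ch s) ×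
    (p * suc (sampleSize D m Tmax δ) ≤ q * ∣ S ∣)
theorem1 = discoverer , 1 , 2 , s≤s z≤n , s≤s z≤n , 18 ,
           λ m Tmax δ _ G s t0 ch valid → Game.most-samples-succeed valid
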